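{- Let $C\ge 2$ be even, $D\ge 1$, and let $\mathcal{S}=(S_i)_{i=1}^{2^{D-1}}$ be a partition of $C\cdot 2^{D-1}$ distinct labels into sets of size $C$. Then in the labeled graph $G_{\mathcal{S}}$, each label $\chi\in\bigcup_i S_i$ induces a tree (the subgraph formed by all edges carrying label $\chi$) that contains the root $r_\chi$ assigned to $\chi$.
   Context: Interleaving: for two sets $S_1,S_2$ of $C$ labels each, $I(S_1,S_2)=\{S_1'\cup S_2' : S_j'\subseteq S_j, |S_j'|=C/2\}$. For a tuple $\mathcal{S}=(S_i)_{i=1}^{2^{D-1}}$ of pairwise disjoint $C$-element label sets ($D\ge 2$), $I(\mathcal{S})=\prod_{i=1}^{2^{D-2}} I(S_{2i-1},S_{2i})$ (Cartesian product), so each element of $I(\mathcal{S})$ is a tuple of $2^{D-2}$ disjoint $C$-element label sets. Construction of the labeled graph $G_{\mathcal{S}}$ (each edge carries a set of labels, each label $\chi$ has a root vertex $r_\chi$), by recursion on $D$: If $D=1$, $\mathcal{S}=(S_1)$ and $G_{\mathcal{S}}$ is a single edge $(r,v)$ carrying all labels of $S_1$, with $r$ the root of every label. If $D>1$: (1) for each $i=1,\dots,2^{D-2}$ introduce new vertices $r_{2i-1},r_{2i},v_i$ and edges $e_{2i-1}=(r_{2i-1},v_i)$, $e_{2i}=(r_{2i},v_i)$; edge $e_j$ carries all labels of $S_j$ and $r_j$ is the root of every label in $S_j$; (2) add the disjoint union of the labeled graphs $G_{\mathcal{S}'}$ for all $\mathcal{S}'\in I(\mathcal{S})$, each edge keeping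 its labels; (3) in each copy $G_{\mathcal{S}'}$, every root vertex $r$ of that copy is incident to a single edge with label set $\chi(r)$; if $\chi(r)\in I(S_{2i-1},S_{2i})$, identify $r$ with $v_i$. The multicast instance $M_{\mathcal{S}}$ on $G_{\mathcal{S}}$ has one tree per label, consisting of the edges carrying that label, rooted at the label's root (roots from step (1)). -}

module Defs where

open import Data.Nat using (ℕ; zero; suc; _+_)
open import Data.Nat.DivMod using (_/_)
open import Data.Nat.Properties using (_≟_)
open import Data.Fin using (Fin; zero; suc)
open import Data.List using (List; []; _∷_; [_]; _++_; map; concatMap; filter; length; lookup)
open import Data.List.Membership.Propositional using (_∈_)
open import Data.List.Membership.DecPropositional _≟_ using (_∈?_)
open import Data.List.Relation.Unary.Any using (Any)
open import Data.Product using (_×_; _,_; proj₁; proj₂)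
open import Data.Sum using (_⊎_)
open import Data.Empty using (⊥)
open import Relation.Binary.PropositionalEquality using (_≡_)
open import Function.Definitions using (Injective)

-- Vertices of the graphs G_S.
--   rt j     : the new root vertex r_{j+1} (0-based index j) of the top level
--   vv i     : the new vertex v_{i+1} (0-based index i) of the top level
--   cp k w   : the copy of the (non-root) vertex w in the k-th copy G_{S'}
--              (k = position of S' in the enumeration of I(S))
-- For D = 1 the single edge is (rt 0 , vv 0), i.e. r = rt 0, v = vv 0.

data Vtx : Set where
  rt : ℕ → Vtx
  vv : ℕ → Vtx
  cp : ℕ → Vtx → Vtx

Edge : Set
Edge = Vtx × Vtx × List ℕ

indexed : {A : Set} → ℕ → List A → List (ℕ × A)
indexed n []       = []
indexed n (x ∷ xs) = (n , x) ∷ indexed (suc n) xs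

choose : {A : Set} → ℕ → List A → List (List A)
choose zero    xs       = [ [] ]
choose (suc k) []       = []
choose (suc k) (x ∷ xs) = map (x ∷_) (choose k xs) ++ choose (suc k) xs

I₂ : ℕ → List ℕ → List ℕ → List (List ℕ)
I₂ h s₁ s₂ = concatMap (λ a → map (a ++_) (choose h s₂)) (choose h s₁)

interleave : ℕ → List (List ℕ) → List (List (List ℕ))
interleave h []               = [ [] ]
interleave h (s ∷ [])         = []
interleave h (s₁ ∷ s₂ ∷ rest) =
  concatMap (λ x → map (x ∷_) (interleave h rest)) (I₂ h s₁ s₂)

-- placing a vertex of the k-th copy: roots r_j of the copy get identified
-- with v_j (since the root r_j of G_{S'} carries S'_j ∈ I(S_{2j-1},S_{2j}))
place : ℕ → Vtx → Vtx
place k (rt j) = vv j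
place k w      = cp k w

placeEdge : ℕ → Edge → Edge
placeEdge k (u , v , L) = (place k u , place k v , L)

newEdges : List (List ℕ) → List Edge
newEdges S = map (λ p → (rt (proj₁ p) , vv (proj₁ p / 2) , proj₂ p)) (indexed 0 S)

G : ℕ → ℕ → List (List ℕ) → List Edge
G h zero                S        = []
G h (suc zero)          []       = []
G h (suc zero)          (s ∷ _)  = [ (rt 0 , vv 0 , s) ]
G h (suc (suc d))       S        =
  newEdges S ++ concatMap (λ p → map (placeEdge (proj₁ p)) (G h (suc d) (proj₂ p)))
                                  (indexed 0 (interleave h S))

GS : (C D : ℕ) → List (List ℕ) → List Edge
GS C D S = G (C / 2) D S

labelEdges : ℕ → List Edge → List (Vtx × Vtx)
labelEdges χ Es = map (λ e → proj₁ e , proj₁ (proj₂ e))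
                      (filter (λ e → χ ∈? proj₂ (proj₂ e)) Es)

Joins : Vtx × Vtx → Vtx → Vtx → Set
Joins (a , b) u v = (a ≡ u × b ≡ v) ⊎ (a ≡ v × b ≡ u)

IsVertex : List (Vtx × Vtx) → Vtx → Set
IsVertex Es v = Any (λ e → proj₁ e ≡ v ⊎ proj₂ e ≡ v) Es

data Walk (Es : List (Vtx × Vtx)) : Vtx → Vtx → Set where
  [] : ∀ {u} → Walk Es u u
  step : ∀ {u v w} → (e : Vtx × Vtx) → e ∈ Es → Joins e u v → Walk Es v w → Walk Es u w

Connected : List (Vtx × Vtx) → Set
Connected Es = ∀ u v → IsVertex Es u → IsVertex Es v → Walk Es u v

-- cyclic successor on Fin (suc k)
rot : ∀ {k} → Fin (suc k) → Fin (suc k)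
rot {zero}  zero    = zero
rot {suc k} zero    = suc zero
rot {suc k} (suc i) with rot i
... | zero  = zero
... | suc m = suc (suc m)

-- a cycle of length n = suc k: distinct vertices vs 0..k, distinct edges
-- (by position in the edge list) es 0..k, edge es i joining vs i and vs (i+1 mod n)
Cycle : List (Vtx × Vtx) → Set
Cycle Es = Data.Product.Σ ℕ λ k →
  Data.Product.Σ (Fin (suc k) → Vtx) λ vs →
  Data.Product.Σ (Fin (suc k) → Fin (length Es)) λ es →
    Injective _≡_ _≡_ vs × Injective _≡_ _≡_ es ×
    (∀ i → Joins (lookup Es (es i)) (vs i) (vs (rot i)))

Acyclic : List (Vtx × Vtx) → Set
Acyclic Es = Cycle Es → ⊥

IsTree : List (Vtx × Vtx) → Set
IsTree Es = Connected Es × Acyclic Es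

module Submission where

-- The proof rests on two facts about G_S that hold by induction on D.
--   * Grading.  Each edge is stored as (parent , child), and the depth
--     function  depth : rt ↦ 0, vv ↦ 1, cp k w ↦ 1 + depth w  increases by
--     exactly one along every edge: the new edges go from r_j to v_i, and
--     copying shifts depths by one while gluing the roots r_j of a copy
--     (depth 0) onto v_j (depth 1).
--   * Unique parents.  Two distinct edges carrying χ never share a child:
--     the two new edges into v_i carry the disjoint sets S_{2i-1}, S_{2i},
--     and children in different copies are different vertices.
-- A graded graph in which distinct edges have distinct children is acyclic
-- (look at a deepest vertex of a cycle: both cycle edges at it would enter
-- it from above).  Connectivity comes from walking upwards: every vertex of
-- the χ-subgraph reaches the root r_j of the unique S_j containing χ, since
-- a copy's root glued onto v_{j'} continues through the new edge e_j.

open import Defs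
open import Data.Nat using (ℕ; zero; suc; _≤_; _+_; _^_; _∸_; _/_; z≤n; s≤s)
open import Data.Nat.Divisibility using (_∣_)
open import Data.Nat.DivMod using (m/n≡1+[m∸n]/n)
open import Data.Nat.Properties using (_≟_; ≤-total; ≤-refl; ≤-trans; n≤1+n; 1+n≰n; 1+n≢n; +-identityʳ; +-suc)
open import Data.Fin using (Fin; zero; suc; toℕ; fromℕ)
open import Data.Fin.Properties using (suc-injective; toℕ-injective)
open import Data.List using (List; []; _∷_; _++_; length; lookup; map; concat; concatMap)
open import Data.List.Membership.Propositional using (_∈_; find; lose)
open import Data.List.Membership.DecPropositional _≟_ using (_∈?_)
open import Data.List.Membership.Propositional.Properties
  using (∈-lookup; ∈-map⁺; ∈-map⁻; ∈-++⁺ˡ; ∈-++⁺ʳ; ∈-++⁻; ∈-concatMap⁺; ∈-concatMap⁻;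
         ∈-filter⁺; ∈-filter⁻; ∈-concat⁺′)
open import Data.List.Relation.Unary.Any using (here; there)
open import Data.List.Relation.Unary.All as All using (All; []; _∷_)
import Data.List.Relation.Unary.All.Properties as AllP
open import Data.List.Relation.Unary.AllPairs as AllPairs using (AllPairs; []; _∷_)
import Data.List.Relation.Unary.AllPairs.Properties as AllPairsP
open import Data.List.Relation.Unary.Unique.Propositional using (Unique)
open import Data.Product using (_×_; _,_; proj₁; proj₂; ∃)
open import Data.Sum using (_⊎_; inj₁; inj₂)
open import Data.Empty using (⊥; ⊥-elim)
open import Relation.Nullary using (Dec)
open import Relation.Binary.PropositionalEquality using (_≡_; _≢_; refl; sym; trans; cong; subst)

joins-sym : ∀ {e u v} → Joins e u v → Joins e v u
joins-sym (inj₁ (a , b)) = inj₂ (a , b)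
joins-sym (inj₂ (a , b)) = inj₁ (a , b)

walk-++ : ∀ {Es u v w} → Walk Es u v → Walk Es v w → Walk Es u w
walk-++ []             q = q
walk-++ (step e m j p) q = step e m j (walk-++ p q)

walk-reverse : ∀ {Es u v} → Walk Es u v → Walk Es v u
walk-reverse []             = []
walk-reverse (step e m j p) = walk-++ (walk-reverse p) (step e m (joins-sym j) [])

mapPair : (Vtx → Vtx) → Vtx × Vtx → Vtx × Vtx
mapPair f (a , b) = f a , f b

walk-map : ∀ (f : Vtx → Vtx) {Es Fs} → (∀ {e} → e ∈ Es → mapPair f e ∈ Fs) →
           ∀ {u v} → Walk Es u v → Walk Fs (f u) (f v)
walk-map f into []                           = []
walk-map f into (step e m (inj₁ (a , b)) p) = step (mapPair f e) (into m) (inj₁ (cong f a , cong f b)) (walk-map f into p)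
walk-map f into (step e m (inj₂ (a , b)) p) = step (mapPair f e) (into m) (inj₂ (cong f a , cong f b)) (walk-map f into p)

connected-via-hub : ∀ {Es} r → (∀ w → IsVertex Es w → Walk Es w r) → Connected Es
connected-via-hub r to-hub u v hu hv = walk-++ (to-hub u hu) (walk-reverse (to-hub v hv))

rot-fromℕ : ∀ k → rot (fromℕ k) ≡ zero
rot-fromℕ zero    = refl
rot-fromℕ (suc k) rewrite rot-fromℕ k = refl

rot-predecessor : ∀ {k} (m : Fin (suc k)) → ∃ λ p → rot p ≡ m
rot-predecessor {k}     zero           = fromℕ k , rot-fromℕ k
rot-predecessor {suc k} (suc zero)     = zero , refl
rot-predecessor {suc k} (suc (suc m)) with rot-predecessor {k} (suc m)
... | p , rot-p≡m = suc p , shift rot-p≡m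
  where
  shift : ∀ {p : Fin (suc k)} {m} → rot p ≡ suc m → rot {suc k} (suc p) ≡ suc (suc m)
  shift eq rewrite eq = refl

maximum-at : ∀ {k} (f : Fin (suc k) → ℕ) → ∃ λ m → ∀ i → f i ≤ f m
maximum-at {zero}  f = zero , λ { zero → ≤-refl }
maximum-at {suc k} f with maximum-at (λ i → f (suc i))
... | m , top with ≤-total (f zero) (f (suc m))
... | inj₁ le = suc m , λ { zero → le ; (suc i) → top i }
... | inj₂ ge = zero  , λ { zero → ≤-refl ; (suc i) → ≤-trans (top i) ge }

StepsDown : (Vtx → ℕ) → Vtx × Vtx → Set
StepsDown ρ e = ρ (proj₂ e) ≡ suc (ρ (proj₁ e))

Graded : (Vtx → ℕ) → List (Vtx × Vtx) → Set
Graded ρ Es = ∀ {e} → e ∈ Es → StepsDown ρ e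

DistinctChildren : List (Vtx × Vtx) → Set
DistinctChildren = AllPairs (λ e e' → proj₂ e ≢ proj₂ e')

enters-deeper-end : ∀ ρ {e u v} → StepsDown ρ e → Joins e u v → ρ v ≤ ρ u → proj₂ e ≡ u
enters-deeper-end ρ {a , b} down (inj₁ (refl , refl)) le = ⊥-elim (1+n≰n (subst (_≤ ρ a) down le))
enters-deeper-end ρ         down (inj₂ (refl , refl)) le = refl

no-loop : ∀ ρ {e u} → StepsDown ρ e → Joins e u u → ⊥
no-loop ρ down (inj₁ (refl , refl)) = 1+n≢n (sym down)
no-loop ρ down (inj₂ (refl , refl)) = 1+n≢n (sym down)

children-determine-positions : ∀ {Es} → DistinctChildren Es →
  ∀ (q q' : Fin (length Es)) → proj₂ (lookup Es q) ≡ proj₂ (lookup Es q') → q ≡ q'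
children-determine-positions (_ ∷ _)    zero    zero     eq = refl
children-determine-positions (ne ∷ _)   zero    (suc q') eq = ⊥-elim (All.lookup ne (∈-lookup q') eq)
children-determine-positions (ne ∷ _)   (suc q) zero     eq = ⊥-elim (All.lookup ne (∈-lookup q) (sym eq))
children-determine-positions (_ ∷ rest) (suc q) (suc q') eq = cong suc (children-determine-positions rest q q' eq)

-- At a deepest vertex vs m of a cycle, both the outgoing cycle edge es m and
-- the incoming one es p (rot p ≡ m) enter vs m, so they coincide; then p ≡ m
-- and es m is a loop, impossible in a graded graph.
graded-acyclic : ∀ ρ {Es} → Graded ρ Es → DistinctChildren Es → Acyclic Es
graded-acyclic ρ {Es} graded distinct (k , vs , es , _ , es-inj , joins) =
  no-loop ρ (down m) (subst (λ z → Joins (lookup Es (es m)) (vs m) (vs z)) rot-m≡m (joins m))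
  where
  down : ∀ q → StepsDown ρ (lookup Es (es q))
  down q = graded (∈-lookup (es q))
  deepest : ∃ λ m → ∀ i → ρ (vs i) ≤ ρ (vs m)
  deepest = maximum-at (λ i → ρ (vs i))
  m : Fin (suc k)
  m = proj₁ deepest
  top : ∀ i → ρ (vs i) ≤ ρ (vs m)
  top = proj₂ deepest
  p : Fin (suc k)
  p = proj₁ (rot-predecessor m)
  rot-p≡m : rot p ≡ m
  rot-p≡m = proj₂ (rot-predecessor m)
  out-enters : proj₂ (lookup Es (es m)) ≡ vs m
  out-enters = enters-deeper-end ρ (down m) (joins m) (top (rot m))
  in-enters : proj₂ (lookup Es (es p)) ≡ vs m
  in-enters = enters-deeper-end ρ (down p)
    (joins-sym (subst (λ z → Joins (lookup Es (es p)) (vs p) (vs z)) rot-p≡m (joins p))) (top p)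
  p≡m : p ≡ m
  p≡m = es-inj (children-determine-positions distinct (es p) (es m) (trans in-enters (sym out-enters)))
  rot-m≡m : rot m ≡ m
  rot-m≡m = trans (cong rot (sym p≡m)) rot-p≡m

indexed-∈⁻ : ∀ {A : Set} {n} {S : List A} {p} → p ∈ indexed n S →
  ∃ λ (j : Fin (length S)) → proj₁ p ≡ n + toℕ j × proj₂ p ≡ lookup S j
indexed-∈⁻ {n = n} {S = s ∷ S} (here refl) = zero , sym (+-identityʳ n) , refl
indexed-∈⁻ {n = n} {S = s ∷ S} (there m) with indexed-∈⁻ m
... | j , pos , val = suc j , trans pos (sym (+-suc n _)) , val

indexed-∈⁺ : ∀ {A : Set} n (S : List A) (j : Fin (length S)) → (n + toℕ j , lookup S j) ∈ indexed n S
indexed-∈⁺ n (s ∷ S) zero    rewrite +-identityʳ n     = here refl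
indexed-∈⁺ n (s ∷ S) (suc j) rewrite +-suc n (toℕ j) = there (indexed-∈⁺ (suc n) S j)

indexed-value : ∀ {A : Set} {n} {S : List A} {p} → p ∈ indexed n S → proj₂ p ∈ S
indexed-value {S = S} m with indexed-∈⁻ m
... | j , _ , val = subst (_∈ S) (sym val) (∈-lookup j)

indexed-≥ : ∀ {A : Set} {n} {S : List A} {p} → p ∈ indexed n S → n ≤ proj₁ p
indexed-≥ {S = s ∷ S} (here refl) = ≤-refl
indexed-≥ {S = s ∷ S} (there m)   = ≤-trans (n≤1+n _) (indexed-≥ m)

indexed-positions-distinct : ∀ {A : Set} n (S : List A) → AllPairs (λ a b → proj₁ a ≢ proj₁ b) (indexed n S)
indexed-positions-distinct n []      = []
indexed-positions-distinct n (s ∷ S) =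
  All.tabulate (λ m eq → 1+n≰n (subst (λ z → suc z ≤ _) eq (indexed-≥ m))) ∷ indexed-positions-distinct (suc n) S

PairwiseDisjoint : List (List ℕ) → Set
PairwiseDisjoint S = ∀ χ (i j : Fin (length S)) → χ ∈ lookup S i → χ ∈ lookup S j → i ≡ j

allPairs-++⁻ : ∀ {A : Set} {R : A → A → Set} (xs : List A) {ys} → AllPairs R (xs ++ ys) →
  AllPairs R ys × (∀ {x y} → x ∈ xs → y ∈ ys → R x y)
allPairs-++⁻ []       ps       = ps , λ ()
allPairs-++⁻ (x ∷ xs) (px ∷ ps) with allPairs-++⁻ xs ps
... | rest , across = rest , λ { (here refl) ym → All.lookup (AllP.++⁻ʳ xs px) ym ; (there xm) ym → across xm ym }

unique-concat⇒disjoint : ∀ S → Unique (concat S) → PairwiseDisjoint S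
unique-concat⇒disjoint (s ∷ S) U χ zero    zero    a b = refl
unique-concat⇒disjoint (s ∷ S) U χ zero    (suc j) a b =
  ⊥-elim (proj₂ (allPairs-++⁻ s U) a (∈-concat⁺′ {xss = S} b (∈-lookup j)) refl)
unique-concat⇒disjoint (s ∷ S) U χ (suc i) zero    a b =
  ⊥-elim (proj₂ (allPairs-++⁻ s U) b (∈-concat⁺′ {xss = S} a (∈-lookup i)) refl)
unique-concat⇒disjoint (s ∷ S) U χ (suc i) (suc j) a b =
  cong suc (unique-concat⇒disjoint S (proj₁ (allPairs-++⁻ s U)) χ i j a b)

indexed-disjoint : ∀ n S → PairwiseDisjoint S →
  AllPairs (λ p q → ∀ χ → χ ∈ proj₂ p → χ ∈ proj₂ q → ⊥) (indexed n S)
indexed-disjoint n []      _        = []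
indexed-disjoint n (s ∷ S) disjoint =
  All.tabulate head ∷ indexed-disjoint (suc n) S (λ χ i j a b → suc-injective (disjoint χ (suc i) (suc j) a b))
  where
  head : ∀ {q} → q ∈ indexed (suc n) S → ∀ χ → χ ∈ s → χ ∈ proj₂ q → ⊥
  head m χ a b with indexed-∈⁻ m
  ... | j , _ , val with disjoint χ zero (suc j) a (subst (χ ∈_) val b)
  ... | ()

choose-⊆ : ∀ {A : Set} k (xs : List A) {a y} → a ∈ choose k xs → y ∈ a → y ∈ xs
choose-⊆ zero    xs       (here refl) ()
choose-⊆ (suc k) (x ∷ xs) m ya with ∈-++⁻ (map (x ∷_) (choose k xs)) m
... | inj₂ m' = there (choose-⊆ (suc k) xs m' ya)
... | inj₁ m' with ∈-map⁻ (x ∷_) m'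
... | a' , a'm , refl with ya
... | here refl = here refl
... | there ya' = there (choose-⊆ k xs a'm ya')

I₂-⊆ : ∀ h s₁ s₂ {x y} → x ∈ I₂ h s₁ s₂ → y ∈ x → y ∈ s₁ ⊎ y ∈ s₂
I₂-⊆ h s₁ s₂ m yx with find (∈-concatMap⁻ (λ a → map (a ++_) (choose h s₂)) {xs = choose h s₁} m)
... | a , am , xm with ∈-map⁻ (a ++_) xm
... | b , bm , refl with ∈-++⁻ a yx
... | inj₁ ya = inj₁ (choose-⊆ h s₁ am ya)
... | inj₂ yb = inj₂ (choose-⊆ h s₂ bm yb)

-- ⌊(n+2)/2⌋ = ⌊n/2⌋ + 1: skipping a pair of positions of S skips one position of S'
half-suc-suc : ∀ n → suc (suc n) / 2 ≡ suc (n / 2)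
half-suc-suc n = m/n≡1+[m∸n]/n {suc (suc n)} {2} (s≤s (s≤s z≤n))

interleave-origin : ∀ h S {S'} → S' ∈ interleave h S → ∀ (j' : Fin (length S')) χ → χ ∈ lookup S' j' →
  ∃ λ (j : Fin (length S)) → χ ∈ lookup S j × toℕ j / 2 ≡ toℕ j'
interleave-origin h [] (here refl) () χ c
interleave-origin h (s ∷ []) () j' χ c
interleave-origin h (s₁ ∷ s₂ ∷ rest) m j' χ c
  with find (∈-concatMap⁻ (λ x → map (x ∷_) (interleave h rest)) {xs = I₂ h s₁ s₂} m)
... | x , xm , S'm with ∈-map⁻ (x ∷_) S'm
... | S'' , S''m , refl with j'
... | zero with I₂-⊆ h s₁ s₂ xm c
... | inj₁ c₁ = zero , c₁ , refl
... | inj₂ c₂ = suc zero , c₂ , refl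
interleave-origin h (s₁ ∷ s₂ ∷ rest) m j' χ c | x , xm , S'm | S'' , S''m , refl | suc j''
  with interleave-origin h rest S''m j'' χ c
... | j , cj , half = suc (suc j) , cj , trans (half-suc-suc (toℕ j)) (cong suc half)

interleave-disjoint : ∀ h S {S'} → PairwiseDisjoint S → S' ∈ interleave h S → PairwiseDisjoint S'
interleave-disjoint h S disjoint m χ a b ca cb
  with interleave-origin h S m a χ ca | interleave-origin h S m b χ cb
... | i , ci , half-i | j , cj , half-j with disjoint χ i j ci cj
... | refl = toℕ-injective (trans (sym half-i) half-j)

parentOf : Edge → Vtx
parentOf E = proj₁ E

childOf : Edge → Vtx
childOf E = proj₁ (proj₂ E)

labelsOf : Edge → List ℕ
labelsOf E = proj₂ (proj₂ E)

copyEdges : ℕ → ℕ → ℕ × List (List ℕ) → List Edge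
copyEdges h d p = map (placeEdge (proj₁ p)) (G h (suc d) (proj₂ p))

newEdge-∈⁻ : ∀ S {E} → E ∈ newEdges S →
  ∃ λ (j : Fin (length S)) → E ≡ (rt (toℕ j) , vv (toℕ j / 2) , lookup S j)
newEdge-∈⁻ S m with ∈-map⁻ (λ p → (rt (proj₁ p) , vv (proj₁ p / 2) , proj₂ p)) m
... | p , pm , refl with indexed-∈⁻ pm
... | j , pos , val rewrite pos | val = j , refl

newEdge-∈⁺ : ∀ S (j : Fin (length S)) → (rt (toℕ j) , vv (toℕ j / 2) , lookup S j) ∈ newEdges S
newEdge-∈⁺ S j = ∈-map⁺ (λ p → (rt (proj₁ p) , vv (proj₁ p / 2) , proj₂ p)) (indexed-∈⁺ 0 S j)

copyEdge-∈⁻ : ∀ h d I {E} → E ∈ concatMap (copyEdges h d) (indexed 0 I) →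
  ∃ λ k → ∃ λ S' → ∃ λ E' → (k , S') ∈ indexed 0 I × E' ∈ G h (suc d) S' × E ≡ placeEdge k E'
copyEdge-∈⁻ h d I m with find (∈-concatMap⁻ (copyEdges h d) {xs = indexed 0 I} m)
... | (k , S') , pm , Em with ∈-map⁻ (placeEdge k) Em
... | E' , E'm , eq = k , S' , E' , pm , E'm , eq

copyEdge-∈⁺ : ∀ h d I {k S' E'} → (k , S') ∈ indexed 0 I → E' ∈ G h (suc d) S' →
  placeEdge k E' ∈ concatMap (copyEdges h d) (indexed 0 I)
copyEdge-∈⁺ h d I pm E'm = ∈-concatMap⁺ (copyEdges h d) (lose pm (∈-map⁺ (placeEdge _) E'm))

depth : Vtx → ℕ
depth (rt _)   = 0
depth (vv _)   = 1
depth (cp _ w) = suc (depth w)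

depth-place : ∀ k w → depth (place k w) ≡ suc (depth w)
depth-place k (rt _)   = refl
depth-place k (vv _)   = refl
depth-place k (cp _ _) = refl

place-injective : ∀ k {x y} → place k x ≡ place k y → x ≡ y
place-injective k {rt a}   {rt .a}    refl = refl
place-injective k {vv a}   {vv .a}    refl = refl
place-injective k {cp a x} {cp .a .x} refl = refl

place-nonroot : ∀ k w {n} → depth w ≡ suc n → place k w ≡ cp k w
place-nonroot k (vv _)   _ = refl
place-nonroot k (cp _ _) _ = refl

endpoints : Edge → Vtx × Vtx
endpoints E = parentOf E , childOf E

-- One level of the construction: new edges go from a root (depth 0) to some
-- v_i (depth 1), and placing a graded copy shifts both ends down by one.
graded-step : ∀ h d S → (∀ S' {E} → E ∈ G h (suc d) S' → StepsDown depth (endpoints E)) →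
  ∀ {E} → E ∈ G h (suc (suc d)) S → StepsDown depth (endpoints E)
graded-step h d S copies-graded m with ∈-++⁻ (newEdges S) m
... | inj₁ new with newEdge-∈⁻ S new
...   | j , refl = refl
graded-step h d S copies-graded m | inj₂ cpy with copyEdge-∈⁻ h d (interleave h S) cpy
...   | k , S' , E' , _ , E'm , refl =
  trans (depth-place k (childOf E'))
        (cong suc (trans (copies-graded S' E'm) (sym (depth-place k (parentOf E')))))

G-graded : ∀ h D S {E} → E ∈ G h D S → StepsDown depth (endpoints E)
G-graded h zero          S       ()
G-graded h (suc zero)    []      ()
G-graded h (suc zero)    (s ∷ S) (here refl) = refl
G-graded h (suc (suc d)) S       m = graded-step h d S (λ S' → G-graded h (suc d) S') m

ChildrenDiffer : ℕ → Edge → Edge → Set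
ChildrenDiffer χ E E' = χ ∈ labelsOf E → χ ∈ labelsOf E' → childOf E ≢ childOf E'

copy-child : ∀ h d {k S' E} → E ∈ map (placeEdge k) (G h (suc d) S') → ∃ λ w → childOf E ≡ cp k w
copy-child h d {k} m with ∈-map⁻ (placeEdge k) m
... | E , Em , refl = childOf E , place-nonroot k (childOf E) (G-graded h (suc d) _ Em)

-- One level of the construction: inside G_S the two new edges into v_i carry
-- disjoint label sets, edges of one copy keep distinct children because placing
-- is injective (using the claim for the copies), and children of different
-- copies, or of a new edge and a copied edge, are different vertices.
children-differ-step : ∀ h d S χ → PairwiseDisjoint S →
  (∀ S' → PairwiseDisjoint S' → AllPairs (ChildrenDiffer χ) (G h (suc d) S')) →
  AllPairs (ChildrenDiffer χ) (G h (suc (suc d)) S)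
children-differ-step h d S χ disjoint copies-differ = AllPairsP.++⁺ within-new within-copies new-vs-copies
  where
  I : List (List (List ℕ))
  I = interleave h S
  within-new : AllPairs (ChildrenDiffer χ) (newEdges S)
  within-new = AllPairsP.map⁺ (AllPairs.map (λ apart c c' _ → apart χ c c') (indexed-disjoint 0 S disjoint))
  within-copy : ∀ {Es} → Es ∈ map (copyEdges h d) (indexed 0 I) → AllPairs (ChildrenDiffer χ) Es
  within-copy m with ∈-map⁻ (copyEdges h d) m
  ... | (k , S') , pm , refl = AllPairsP.map⁺ (AllPairs.map (λ differ c c' eq → differ c c' (place-injective k eq))
          (copies-differ S' (interleave-disjoint h S disjoint (indexed-value pm))))
  between-copies : ∀ {p q} → proj₁ p ≢ proj₁ q →
    All (λ E → All (ChildrenDiffer χ E) (copyEdges h d q)) (copyEdges h d p)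
  between-copies k≢k' = All.tabulate λ Em → All.tabulate λ E'm _ _ eq →
    k≢k' (cp-injective (trans (sym (proj₂ (copy-child h d Em))) (trans eq (proj₂ (copy-child h d E'm)))))
    where
    cp-injective : ∀ {a b x y} → cp a x ≡ cp b y → a ≡ b
    cp-injective refl = refl
  within-copies : AllPairs (ChildrenDiffer χ) (concatMap (copyEdges h d) (indexed 0 I))
  within-copies = AllPairsP.concat⁺ (All.tabulate within-copy)
    (AllPairsP.map⁺ (AllPairs.map between-copies (indexed-positions-distinct 0 I)))
  new-vs-copies : All (λ E → All (ChildrenDiffer χ E) (concatMap (copyEdges h d) (indexed 0 I))) (newEdges S)
  new-vs-copies = All.tabulate λ new → All.tabulate λ cpy _ _ → apart new cpy
    where
    apart : ∀ {E E'} → E ∈ newEdges S → E' ∈ concatMap (copyEdges h d) (indexed 0 I) → childOf E ≢ childOf E'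
    apart new cpy with newEdge-∈⁻ S new | copyEdge-∈⁻ h d I cpy
    ... | j , refl | k , S' , E' , _ , E'm , refl
      rewrite place-nonroot k (childOf E') (G-graded h (suc d) S' E'm) = λ ()

G-children-differ : ∀ h D S χ → PairwiseDisjoint S → AllPairs (ChildrenDiffer χ) (G h D S)
G-children-differ h zero          S       χ _ = []
G-children-differ h (suc zero)    []      χ _ = []
G-children-differ h (suc zero)    (s ∷ S) χ _ = [] ∷ []
G-children-differ h (suc (suc d)) S       χ disjoint =
  children-differ-step h d S χ disjoint (λ S' → G-children-differ h (suc d) S' χ)

labelEdges-∈⁺ : ∀ {χ Es E} → E ∈ Es → χ ∈ labelsOf E → endpoints E ∈ labelEdges χ Es
labelEdges-∈⁺ {χ} m c = ∈-map⁺ endpoints (∈-filter⁺ (λ E → χ ∈? labelsOf E) m c)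

labelEdges-∈⁻ : ∀ {χ Es e} → e ∈ labelEdges χ Es → ∃ λ E → E ∈ Es × χ ∈ labelsOf E × e ≡ endpoints E
labelEdges-∈⁻ {χ} m with ∈-map⁻ endpoints m
... | E , Em , refl with ∈-filter⁻ (λ E → χ ∈? labelsOf E) Em
... | E∈ , c = E , E∈ , c , refl

labelVertex⁻ : ∀ {χ Es w} → IsVertex (labelEdges χ Es) w →
  ∃ λ E → E ∈ Es × χ ∈ labelsOf E × (parentOf E ≡ w ⊎ childOf E ≡ w)
labelVertex⁻ isv with find isv
... | e , em , at with labelEdges-∈⁻ em
... | E , Em , c , refl = E , Em , c , at

labelEdges-graded : ∀ ρ {χ Es} → (∀ {E} → E ∈ Es → StepsDown ρ (endpoints E)) → Graded ρ (labelEdges χ Es)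
labelEdges-graded ρ graded m with labelEdges-∈⁻ m
... | E , Em , _ , refl = graded Em

labelEdges-distinct-children : ∀ χ Es → AllPairs (ChildrenDiffer χ) Es → DistinctChildren (labelEdges χ Es)
labelEdges-distinct-children χ Es differ =
  AllPairsP.map⁺ (discharge (AllP.all-filter has-χ Es) (AllPairsP.filter⁺ has-χ differ))
  where
  has-χ : ∀ E → Dec (χ ∈ labelsOf E)
  has-χ E = χ ∈? labelsOf E
  discharge : ∀ {Fs} → All (λ E → χ ∈ labelsOf E) Fs → AllPairs (ChildrenDiffer χ) Fs →
              AllPairs (λ E E' → childOf E ≢ childOf E') Fs
  discharge []       []       = []
  discharge (c ∷ cs) (d ∷ ds) = All.zipWith (λ (c' , d') → d' c c') (cs , d) ∷ discharge cs ds

ReachesRoot : ℕ → ℕ → List (List ℕ) → ℕ → Vtx → Set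
ReachesRoot h D S χ w =
  ∃ λ (j : Fin (length S)) → χ ∈ lookup S j × Walk (labelEdges χ (G h D S)) w (rt (toℕ j))

up-new-edge : ∀ h d S χ (j : Fin (length S)) → χ ∈ lookup S j →
  Walk (labelEdges χ (G h (suc (suc d)) S)) (vv (toℕ j / 2)) (rt (toℕ j))
up-new-edge h d S χ j c = step _ (labelEdges-∈⁺ (∈-++⁺ˡ (newEdge-∈⁺ S j)) c) (inj₂ (refl , refl)) []

copy-label-edge : ∀ h d S {k S' χ e} → (k , S') ∈ indexed 0 (interleave h S) →
  e ∈ labelEdges χ (G h (suc d) S') → mapPair (place k) e ∈ labelEdges χ (G h (suc (suc d)) S)
copy-label-edge h d S pm em with labelEdges-∈⁻ em
... | E' , E'm , c , refl = labelEdges-∈⁺ (∈-++⁺ʳ (newEdges S) (copyEdge-∈⁺ h d (interleave h S) pm E'm)) c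

-- A walk to the root r_{j'} of the copy G_{S'} ends at v_{j'} once placed; the
-- label comes from some S_j with ⌊j/2⌋ = j', and e_j continues up to r_j.
reach-from-copy : ∀ h d S χ {k S'} → (k , S') ∈ indexed 0 (interleave h S) →
  ∀ {w} → ReachesRoot h (suc d) S' χ w → ReachesRoot h (suc (suc d)) S χ (place k w)
reach-from-copy h d S χ pm (j' , c' , walk) with interleave-origin h S (indexed-value pm) j' χ c'
... | j , c , half = j , c ,
  walk-++ (walk-map (place _) (copy-label-edge h d S pm) walk)
          (subst (λ i → Walk _ (vv i) (rt (toℕ j))) half (up-new-edge h d S χ j c))

-- One level of the construction: a vertex on a new edge e_j reaches r_j
-- directly, a vertex of a copy reaches its root in the copy and continues.
reaches-root-step : ∀ h d S χ →
  (∀ S' w → IsVertex (labelEdges χ (G h (suc d) S')) w → ReachesRoot h (suc d) S' χ w) →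
  ∀ w → IsVertex (labelEdges χ (G h (suc (suc d)) S)) w → ReachesRoot h (suc (suc d)) S χ w
reaches-root-step h d S χ copies-reach w isv with labelVertex⁻ {χ} {G h (suc (suc d)) S} isv
... | E , Em , c , at with ∈-++⁻ (newEdges S) Em
...   | inj₁ new with newEdge-∈⁻ S new | at
...     | j , refl | inj₁ refl = j , c , []
...     | j , refl | inj₂ refl = j , c , up-new-edge h d S χ j c
reaches-root-step h d S χ copies-reach w isv | E , Em , c , at | inj₂ cpy
  with copyEdge-∈⁻ h d (interleave h S) cpy | at
... | k , S' , E' , pm , E'm , refl | inj₁ refl =
  reach-from-copy h d S χ pm (copies-reach S' _ (lose (labelEdges-∈⁺ E'm c) (inj₁ refl)))
... | k , S' , E' , pm , E'm , refl | inj₂ refl =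
  reach-from-copy h d S χ pm (copies-reach S' _ (lose (labelEdges-∈⁺ E'm c) (inj₂ refl)))

G-reaches-root : ∀ h D S χ w → IsVertex (labelEdges χ (G h D S)) w → ReachesRoot h D S χ w
G-reaches-root h zero       S       χ w isv with labelVertex⁻ {χ} {G h zero S} isv
... | _ , () , _
G-reaches-root h (suc zero) []      χ w isv with labelVertex⁻ {χ} {G h (suc zero) []} isv
... | _ , () , _
G-reaches-root h (suc zero) (s ∷ S) χ w isv with labelVertex⁻ {χ} {G h (suc zero) (s ∷ S)} isv
... | _ , here refl , c , inj₁ refl = zero , c , []
... | _ , here refl , c , inj₂ refl = zero , c , step _ (labelEdges-∈⁺ (here refl) c) (inj₂ (refl , refl)) []
G-reaches-root h (suc (suc d)) S χ =
  reaches-root-step h d S χ (λ S' → G-reaches-root h (suc d) S' χ)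

-- The root r_j is the parent of the edge e_j, which carries every label of S_j.
root-in-label-subgraph : ∀ h D → 1 ≤ D → ∀ S → length S ≡ 2 ^ (D ∸ 1) →
  ∀ (j : Fin (length S)) χ → χ ∈ lookup S j → IsVertex (labelEdges χ (G h D S)) (rt (toℕ j))
root-in-label-subgraph h (suc zero)    _ (s ∷ []) _ zero χ c =
  lose (labelEdges-∈⁺ {χ} {G h 1 (s ∷ [])} (here refl) c) (inj₁ refl)
root-in-label-subgraph h (suc (suc d)) _ S        _ j    χ c =
  lose (labelEdges-∈⁺ {χ} {G h (suc (suc d)) S} (∈-++⁺ˡ (newEdge-∈⁺ S j)) c) (inj₁ refl)

-- The χ-subgraph is acyclic by the grading criterion, connected through the
-- hub r_j (the only root a vertex can reach, by disjointness), and contains r_j.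
lemma1 : (C D : ℕ) → 2 ≤ C → 2 ∣ C → 1 ≤ D →
    (S : List (List ℕ)) → length S ≡ 2 ^ (D ∸ 1) →
    All (λ s → length s ≡ C) S → Unique (concat S) →
    (j : Fin (length S)) (χ : ℕ) → χ ∈ lookup S j →
    IsTree (labelEdges χ (GS C D S)) × IsVertex (labelEdges χ (GS C D S)) (rt (toℕ j))
lemma1 C D _ _ 1≤D S length-S _ unique j χ χ∈Sj = (connected , acyclic) , has-root
  where
  h : ℕ
  h = C / 2
  disjoint : PairwiseDisjoint S
  disjoint = unique-concat⇒disjoint S unique
  to-root : ∀ w → IsVertex (labelEdges χ (G h D S)) w → Walk (labelEdges χ (G h D S)) w (rt (toℕ j))
  to-root w isv with G-reaches-root h D S χ w isv
  ... | j' , χ∈Sj' , walk with disjoint χ j' j χ∈Sj' χ∈Sj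
  ... | refl = walk
  connected : Connected (labelEdges χ (G h D S))
  connected = connected-via-hub (rt (toℕ j)) to-root
  acyclic : Acyclic (labelEdges χ (G h D S))
  acyclic = graded-acyclic depth (labelEdges-graded depth (G-graded h D S))
    (labelEdges-distinct-children χ (G h D S) (G-children-differ h D S χ disjoint))
  has-root : IsVertex (labelEdges χ (G h D S)) (rt (toℕ j))
  has-root = root-in-label-subgraph h D 1≤D S length-S j χ χ∈Sj
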